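{- Let $(\mathcal{P},\mathcal{B})$ be the design defined below. The set of blocks $$C_1=\{B_1^{11},B_2^1,B_3^1,B_4^{10},B_5^{10},B_6^{11},B_7^6,B_9^{12},B_{10}^4,B_{11}^0,B_{11}^2,B_{11}^3,B_{11}^7\}$$ is a non-canonical maximum clique in the block graph of $(\mathcal{P},\mathcal{B})$.
   Context: Point set: $\mathcal{P}=\mathbb{Z}_{13}\times(\{0,1,2\}\cup\{a,b\})\cup\{\infty\}$ ($66$ points); the point $(i,x)$ is written $i_x$. Basic blocks: $B_1=\{2_0,5_0,4_1,9_1,0_a,6_a\}$, $B_2=\{1_0,2_0,6_0,12_2,5_b,8_b\}$, $B_3=\{6_1,2_1,12_2,1_2,0_a,5_a\}$, $B_4=\{3_1,6_1,5_1,10_0,2_b,11_b\}$, $B_5=\{5_2,6_2,10_0,3_0,0_a,2_a\}$, $B_6=\{9_2,5_2,2_2,4_1,6_b,7_b\}$, $B_7=\{7_0,9_0,10_1,1_2,3_a,4_b\}$, $B_8=\{2_a,6_a,5_a,4_b,12_b,10_b\}$, $B_9=\{8_1,1_1,4_2,3_0,9_a,12_b\}$, $B_{10}=\{11_2,3_2,12_0,9_1,1_a,10_b\}$, $B_{11}=\{\infty,0_0,0_1,0_2,0_a,0_b\}$. For $e\in\mathbb{Z}_{13}$, $B_i^e$ is obtained from $B_i$ by replacing each point $j_x$ by $(j+e)_x$ (addition mod $13$) and fixing $\infty$. The block set is $\mathcal{B}=\{B_i^e: 1\le i\le 11,\ e\in\mathbb{Z}_{13}\}$ ($143$ blocks);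 $(\mathcal{P},\mathcal{B})$ is a $2$-$(66,6,1)$ design (every pair of distinct points lies in exactly one block). The block graph has the blocks as vertices, two distinct blocks adjacent iff they intersect. A maximum clique here has size $\frac{66-1}{6-1}=13$; a maximum clique is canonical if it consists of all blocks containing a fixed point, and non-canonical otherwise. -}

module Defs where

open import Data.Nat using (ℕ; _≤_)
open import Data.Nat.DivMod using (_mod_)
open import Data.Fin using (Fin; _+_; toℕ)
open import Data.Product using (_×_; _,_; ∃)
open import Data.List using (List; []; _∷_; map; length)
open import Data.List.Membership.Propositional using (_∈_)
open import Data.List.Relation.Unary.Unique.Propositional using (Unique)
open import Relation.Binary.PropositionalEquality using (_≡_)
open import Relation.Nullary using (¬_)
open import Function.Bundles using (_⇔_)

data Kind : Set where
  k0 k1 k2 ka kb : Kind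

-- Points of 𝒫 = ℤ₁₃ × ({0,1,2} ∪ {a,b}) ∪ {∞}; ℤ₁₃ is Fin 13 (arithmetic mod 13)
data Point : Set where
  pt : Fin 13 → Kind → Point
  ∞  : Point

_⟨_⟩ : ℕ → Kind → Point
j ⟨ x ⟩ = pt (j mod 13) x

-- basic blocks B₁ … B₁₁, indexed by Fin 11 (index i stands for B_{i+1})
basic : Fin 11 → List Point
basic Fin.zero = 2 ⟨ k0 ⟩ ∷ 5 ⟨ k0 ⟩ ∷ 4 ⟨ k1 ⟩ ∷ 9 ⟨ k1 ⟩ ∷ 0 ⟨ ka ⟩ ∷ 6 ⟨ ka ⟩ ∷ []
basic (Fin.suc Fin.zero) = 1 ⟨ k0 ⟩ ∷ 2 ⟨ k0 ⟩ ∷ 6 ⟨ k0 ⟩ ∷ 12 ⟨ k2 ⟩ ∷ 5 ⟨ kb ⟩ ∷ 8 ⟨ kb ⟩ ∷ []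
basic (Fin.suc (Fin.suc Fin.zero)) = 6 ⟨ k1 ⟩ ∷ 2 ⟨ k1 ⟩ ∷ 12 ⟨ k2 ⟩ ∷ 1 ⟨ k2 ⟩ ∷ 0 ⟨ ka ⟩ ∷ 5 ⟨ ka ⟩ ∷ []
basic (Fin.suc (Fin.suc (Fin.suc Fin.zero))) = 3 ⟨ k1 ⟩ ∷ 6 ⟨ k1 ⟩ ∷ 5 ⟨ k1 ⟩ ∷ 10 ⟨ k0 ⟩ ∷ 2 ⟨ kb ⟩ ∷ 11 ⟨ kb ⟩ ∷ []
basic (Fin.suc (Fin.suc (Fin.suc (Fin.suc Fin.zero)))) = 5 ⟨ k2 ⟩ ∷ 6 ⟨ k2 ⟩ ∷ 10 ⟨ k0 ⟩ ∷ 3 ⟨ k0 ⟩ ∷ 0 ⟨ ka ⟩ ∷ 2 ⟨ ka ⟩ ∷ []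
basic (Fin.suc (Fin.suc (Fin.suc (Fin.suc (Fin.suc Fin.zero))))) = 9 ⟨ k2 ⟩ ∷ 5 ⟨ k2 ⟩ ∷ 2 ⟨ k2 ⟩ ∷ 4 ⟨ k1 ⟩ ∷ 6 ⟨ kb ⟩ ∷ 7 ⟨ kb ⟩ ∷ []
basic (Fin.suc (Fin.suc (Fin.suc (Fin.suc (Fin.suc (Fin.suc Fin.zero)))))) = 7 ⟨ k0 ⟩ ∷ 9 ⟨ k0 ⟩ ∷ 10 ⟨ k1 ⟩ ∷ 1 ⟨ k2 ⟩ ∷ 3 ⟨ ka ⟩ ∷ 4 ⟨ kb ⟩ ∷ []
basic (Fin.suc (Fin.suc (Fin.suc (Fin.suc (Fin.suc (Fin.suc (Fin.suc Fin.zero))))))) = 2 ⟨ ka ⟩ ∷ 6 ⟨ ka ⟩ ∷ 5 ⟨ ka ⟩ ∷ 4 ⟨ kb ⟩ ∷ 12 ⟨ kb ⟩ ∷ 10 ⟨ kb ⟩ ∷ []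
basic (Fin.suc (Fin.suc (Fin.suc (Fin.suc (Fin.suc (Fin.suc (Fin.suc (Fin.suc Fin.zero)))))))) = 8 ⟨ k1 ⟩ ∷ 1 ⟨ k1 ⟩ ∷ 4 ⟨ k2 ⟩ ∷ 3 ⟨ k0 ⟩ ∷ 9 ⟨ ka ⟩ ∷ 12 ⟨ kb ⟩ ∷ []
basic (Fin.suc (Fin.suc (Fin.suc (Fin.suc (Fin.suc (Fin.suc (Fin.suc (Fin.suc (Fin.suc Fin.zero))))))))) = 11 ⟨ k2 ⟩ ∷ 3 ⟨ k2 ⟩ ∷ 12 ⟨ k0 ⟩ ∷ 9 ⟨ k1 ⟩ ∷ 1 ⟨ ka ⟩ ∷ 10 ⟨ kb ⟩ ∷ []
basic (Fin.suc (Fin.suc (Fin.suc (Fin.suc (Fin.suc (Fin.suc (Fin.suc (Fin.suc (Fin.suc (Fin.suc Fin.zero)))))))))) = ∞ ∷ 0 ⟨ k0 ⟩ ∷ 0 ⟨ k1 ⟩ ∷ 0 ⟨ k2 ⟩ ∷ 0 ⟨ ka ⟩ ∷ 0 ⟨ kb ⟩ ∷ []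

shift : Fin 13 → Point → Point
shift e (pt j x) = pt (((toℕ j) Data.Nat.+ (toℕ e)) mod 13) x
shift e ∞ = ∞

-- Vertices of the block graph: the 143 blocks B_i^e, indexed by (i , e)
BlockIx : Set
BlockIx = Fin 11 × Fin 13

block : BlockIx → List Point
block (i , e) = map (shift e) (basic i)

-- B_i^e, with 1 ≤ i ≤ 11 and e given as natural numbers as in the paper
B : ℕ → ℕ → BlockIx
B i e = (Data.Nat.pred i mod 11 , e mod 13)

Intersect : BlockIx → BlockIx → Set
Intersect u v = ∃ λ p → p ∈ block u × p ∈ block v

IsClique : List BlockIx → Set
IsClique C = Unique C × (∀ u v → u ∈ C → v ∈ C → ¬ u ≡ v → Intersect u v)

IsMaximumClique : List BlockIx → Set
IsMaximumClique C = IsClique C × (∀ D → IsClique D → length D ≤ length C)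

IsCanonical : List BlockIx → Set
IsCanonical C = ∃ λ p → ∀ u → (u ∈ C ⇔ p ∈ block u)

C₁ : List BlockIx
C₁ = B 1 11 ∷ B 2 1 ∷ B 3 1 ∷ B 4 10 ∷ B 5 10 ∷ B 6 11 ∷ B 7 6 ∷ B 9 12
   ∷ B 10 4 ∷ B 11 0 ∷ B 11 2 ∷ B 11 3 ∷ B 11 7 ∷ []

-- Counting alone cannot bound the clique size by 13: pairwise intersecting blocks
-- without a common point could a priori number up to k² − k + 1 = 31. So maximality
-- is established by an exhaustive branch-and-bound search over the 143 blocks, proved
-- sound once and for all. C₁ is not canonical because three of its blocks have no
-- common point.
module Submission where

open import Defs
open import Data.Product using (_×_)
open import Relation.Nullary using (¬_)

open import Data.Bool using (Bool; true; false; T; _∧_; _∨_)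
open import Data.Bool.Properties using (T-∧; T-∨; T-≡)
open import Data.Fin using (Fin)
open import Data.Fin.Properties using () renaming (_≟_ to _≟ᶠ_)
open import Data.List using (List; []; _∷_; length; filter; filterᵇ; allFin; cartesianProduct)
open import Data.List.Properties using (filter-reject; filter-all)
open import Data.List.Membership.Propositional using (_∈_; _∉_; find; lose)
open import Data.List.Membership.Propositional.Properties
  using (∈-filter⁻; ∈-filter⁺; ∈-allFin; ∈-cartesianProduct⁺)
import Data.List.Membership.DecPropositional as DecMembership
open import Data.List.Relation.Binary.Subset.Propositional using (_⊆_)
open import Data.List.Relation.Binary.Subset.Propositional.Properties using (⊆[]⇒≡[]; ⊆∷⇒∈∨⊆)
open import Data.List.Relation.Unary.All as All using (All; all?)
open import Data.List.Relation.Unary.Any using (here; there; any?)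
open import Data.List.Relation.Unary.Unique.Propositional using (Unique; _∷_)
import Data.List.Relation.Unary.Unique.Propositional.Properties as Unique
open import Data.List.Relation.Unary.Unique.DecPropositional using (unique?)
open import Data.Nat using (ℕ; zero; suc; _≤_; _≤ᵇ_; z≤n; s≤s)
open import Data.Nat.Properties using (≤ᵇ⇒≤; ≤-trans; m≤n⇒m≤1+n)
open import Data.Product using (∃; _,_; proj₁; proj₂)
open import Data.Product.Properties using (≡-dec)
open import Data.Sum using (inj₁; inj₂)
open import Data.Vec using (Vec; lookup; tabulate)
open import Data.Vec.Properties using (lookup∘tabulate)
open import Function using (_∘_)
open import Function.Bundles using (Equivalence)
open import Relation.Binary.Definitions using (DecidableEquality)
open import Relation.Binary.PropositionalEquality
  using (_≡_; _≢_; refl; sym; trans; cong; cong₂; subst; ≢-sym; module ≡-Reasoning)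
open import Relation.Nullary using (Dec; yes; no; does; ¬?; contradiction)
open import Relation.Nullary.Decidable
  using (True; toWitness; from-yes; map′; dec-true; T?; _×-dec_; _→-dec_)

module _ {A : Set} (_≟_ : DecidableEquality A) where

  open DecMembership _≟_ using (_∈?_)

  commonElement? : (xs ys : List A) → Dec (∃ λ x → x ∈ xs × x ∈ ys)
  commonElement? xs ys =
    map′ find (λ (_ , x∈xs , x∈ys) → lose x∈xs x∈ys) (any? (_∈? ys) xs)

  without : A → List A → List A
  without v = filter (λ w → ¬? (w ≟ v))

  length-without : ∀ {v D} → Unique D → v ∈ D → length D ≡ suc (length (without v D))
  length-without {v} {v ∷ xs} (v∉xs ∷ _) (here refl) = cong suc (begin
    length xs                   ≡⟨ cong length (filter-all (λ w → ¬? (w ≟ v)) (All.map ≢-sym v∉xs)) ⟨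
    length (without v xs)       ≡⟨ cong length (filter-reject (λ w → ¬? (w ≟ v)) (λ v≢v → v≢v refl)) ⟨
    length (without v (v ∷ xs)) ∎)
    where open ≡-Reasoning
  length-without {v} {x ∷ xs} (x∉xs ∷ uxs) (there v∈xs) with x ≟ v
  ... | yes refl = contradiction refl (All.lookup x∉xs v∈xs)
  ... | no  _    = cong suc (length-without uxs v∈xs)

  without-⊆ : ∀ {v D} → without v D ⊆ D
  without-⊆ {v} {D} = proj₁ ∘ ∈-filter⁻ (λ w → ¬? (w ≟ v)) {xs = D}

  without-≢ : ∀ {v w D} → w ∈ without v D → w ≢ v
  without-≢ {v} {D = D} = proj₂ ∘ ∈-filter⁻ (λ w → ¬? (w ≟ v)) {xs = D}

  without-⊆-tail : ∀ {v D S} → D ⊆ v ∷ S → without v D ⊆ S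
  without-⊆-tail {D = D} D⊆v∷S w∈ with D⊆v∷S (without-⊆ {D = D} w∈)
  ... | here w≡v  = contradiction w≡v (without-≢ {D = D} w∈)
  ... | there w∈S = w∈S

  Unique∧⊆⇒length≤ : ∀ {D S} → Unique D → D ⊆ S → length D ≤ length S
  Unique∧⊆⇒length≤ {D} {[]} _ D⊆[] rewrite ⊆[]⇒≡[] D⊆[] = z≤n
  Unique∧⊆⇒length≤ {D} {v ∷ S} uD D⊆v∷S with ⊆∷⇒∈∨⊆ D⊆v∷S
  ... | inj₁ v∈D = subst (_≤ suc (length S)) (sym (length-without uD v∈D))
                     (s≤s (Unique∧⊆⇒length≤ (Unique.filter⁺ _ uD) (without-⊆-tail D⊆v∷S)))
  ... | inj₂ D⊆S = m≤n⇒m≤1+n (Unique∧⊆⇒length≤ uD D⊆S)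

  module _ (adj : A → A → Bool) where

    IsCliqueᵇ : List A → Set
    IsCliqueᵇ D = Unique D × (∀ {u w} → u ∈ D → w ∈ D → u ≢ w → T (adj u w))

    -- Branch and bound: a clique inside v ∷ S either avoids v, or is v together
    -- with a clique inside the neighbours of v in S.
    cliqueSizeAtMost : (fuel : ℕ) → List A → ℕ → Bool
    cliqueSizeAtMost _        []      _       = true
    cliqueSizeAtMost zero     (_ ∷ _) _       = false
    cliqueSizeAtMost (suc _)  (_ ∷ _) zero    = false
    cliqueSizeAtMost (suc n)  (v ∷ S) (suc k) =
      (length S ≤ᵇ k) ∨ (cliqueSizeAtMost n (filterᵇ (adj v) S) k ∧ cliqueSizeAtMost n S (suc k))

    cliqueSizeAtMost-sound : ∀ n S k {D} → cliqueSizeAtMost n S k ≡ true →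
                             IsCliqueᵇ D → D ⊆ S → length D ≤ k
    cliqueSizeAtMost-sound _ [] _ {D} _ _ D⊆[] rewrite ⊆[]⇒≡[] D⊆[] = z≤n
    cliqueSizeAtMost-sound (suc n) (v ∷ S) (suc k) {D} ok (uD , adjD) D⊆v∷S
      with Equivalence.to T-∨ (Equivalence.from T-≡ ok)
    ... | inj₁ |S|≤k = ≤-trans (Unique∧⊆⇒length≤ uD D⊆v∷S) (s≤s (≤ᵇ⇒≤ _ _ |S|≤k))
    ... | inj₂ ok′ with Equivalence.to T-∧ ok′ | ⊆∷⇒∈∨⊆ D⊆v∷S
    ...   | _ , okS | inj₂ D⊆S =
      cliqueSizeAtMost-sound n S (suc k) (Equivalence.to T-≡ okS) (uD , adjD) D⊆S
    ...   | okN , _ | inj₁ v∈D =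
      subst (_≤ suc k) (sym (length-without uD v∈D))
        (s≤s (cliqueSizeAtMost-sound n (filterᵇ (adj v) S) k (Equivalence.to T-≡ okN)
                (uD′ , adjD′) D′⊆N))
      where
        uD′ : Unique (without v D)
        uD′ = Unique.filter⁺ _ uD
        adjD′ : ∀ {u w} → u ∈ without v D → w ∈ without v D → u ≢ w → T (adj u w)
        adjD′ u∈ w∈ = adjD (without-⊆ {D = D} u∈) (without-⊆ {D = D} w∈)
        D′⊆N : without v D ⊆ filterᵇ (adj v) S
        D′⊆N w∈ = ∈-filter⁺ (T? ∘ adj v) (without-⊆-tail D⊆v∷S w∈)
                    (adjD v∈D (without-⊆ {D = D} w∈) (≢-sym (without-≢ {D = D} w∈)))

kindIndex : Kind → Fin 5
kindIndex k0 = Fin.zero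
kindIndex k1 = Fin.suc Fin.zero
kindIndex k2 = Fin.suc (Fin.suc Fin.zero)
kindIndex ka = Fin.suc (Fin.suc (Fin.suc Fin.zero))
kindIndex kb = Fin.suc (Fin.suc (Fin.suc (Fin.suc Fin.zero)))

kindIndex-injective : ∀ {x y} → kindIndex x ≡ kindIndex y → x ≡ y
kindIndex-injective {k0} {k0} _ = refl
kindIndex-injective {k1} {k1} _ = refl
kindIndex-injective {k2} {k2} _ = refl
kindIndex-injective {ka} {ka} _ = refl
kindIndex-injective {kb} {kb} _ = refl

_≟ᵏ_ : DecidableEquality Kind
x ≟ᵏ y = map′ kindIndex-injective (cong kindIndex) (kindIndex x ≟ᶠ kindIndex y)

_≟ᵖ_ : DecidableEquality Point
pt i x ≟ᵖ pt j y = map′ (λ (i≡j , x≡y) → cong₂ pt i≡j x≡y) (λ { refl → refl , refl })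
                        (i ≟ᶠ j ×-dec x ≟ᵏ y)
pt _ _ ≟ᵖ ∞      = no λ ()
∞      ≟ᵖ pt _ _ = no λ ()
∞      ≟ᵖ ∞      = yes refl

_≟ᵇ_ : DecidableEquality BlockIx
_≟ᵇ_ = ≡-dec _≟ᶠ_ _≟ᶠ_

intersect? : ∀ u v → Dec (Intersect u v)
intersect? u v = commonElement? _≟ᵖ_ (block u) (block v)

isClique? : ∀ C → Dec (IsClique C)
isClique? C = unique? _≟ᵇ_ C ×-dec map′ lookup₂ tabulate₂ pairs?
  where
  Pairs : Set
  Pairs = All (λ u → All (λ v → u ≢ v → Intersect u v) C) C
  pairs? : Dec Pairs
  pairs? = all? (λ u → all? (λ v → ¬? (u ≟ᵇ v) →-dec intersect? u v) C) C
  lookup₂ : Pairs → ∀ u v → u ∈ C → v ∈ C → u ≢ v → Intersect u v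
  lookup₂ h _ _ u∈ v∈ = All.lookup (All.lookup h u∈) v∈
  tabulate₂ : (∀ u v → u ∈ C → v ∈ C → u ≢ v → Intersect u v) → Pairs
  tabulate₂ h = All.tabulate λ u∈ → All.tabulate λ v∈ → h _ _ u∈ v∈

allBlocks : List BlockIx
allBlocks = cartesianProduct (allFin 11) (allFin 13)

∈-allBlocks : ∀ u → u ∈ allBlocks
∈-allBlocks (i , e) = ∈-cartesianProduct⁺ (∈-allFin i) (∈-allFin e)

BlockTable : Set → Set
BlockTable X = Vec (Vec X 13) 11

tabulateᵇ : ∀ {X} → (BlockIx → X) → BlockTable X
tabulateᵇ f = tabulate λ i → tabulate λ e → f (i , e)

lookupᵇ : ∀ {X} → BlockTable X → BlockIx → X
lookupᵇ t (i , e) = lookup (lookup t i) e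

lookupᵇ∘tabulateᵇ : ∀ {X} (f : BlockIx → X) u → lookupᵇ (tabulateᵇ f) u ≡ f u
lookupᵇ∘tabulateᵇ f (i , e) =
  trans (cong (λ row → lookup row e) (lookup∘tabulate (λ i → tabulate λ e → f (i , e)) i))
        (lookup∘tabulate (λ e → f (i , e)) e)

intersects : BlockIx → BlockIx → Bool
intersects u v = does (intersect? u v)

-- The search looks adjacency up in this table, which the evaluator builds lazily and
-- shares, so each of the 143² intersections is computed at most once.
adjacencyTable : BlockTable (BlockTable Bool)
adjacencyTable = tabulateᵇ λ u → tabulateᵇ (intersects u)

adjacentIn : BlockTable (BlockTable Bool) → BlockIx → BlockIx → Bool
adjacentIn t u v = lookupᵇ (lookupᵇ t u) v

adjacentIn-adjacencyTable : ∀ u v → adjacentIn adjacencyTable u v ≡ intersects u v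
adjacentIn-adjacencyTable u v =
  trans (cong (λ row → lookupᵇ row v) (lookupᵇ∘tabulateᵇ (λ w → tabulateᵇ (intersects w)) u))
        (lookupᵇ∘tabulateᵇ (intersects u) v)

adjacent-complete : ∀ {u v} → Intersect u v → T (adjacentIn adjacencyTable u v)
adjacent-complete {u} {v} u∩v =
  Equivalence.from T-≡ (trans (adjacentIn-adjacencyTable u v) (dec-true (intersect? u v) u∩v))

clique⇒cliqueᵇ : ∀ {D} → IsClique D → IsCliqueᵇ _≟ᵇ_ (adjacentIn adjacencyTable) D
clique⇒cliqueᵇ (uD , meet) = uD , λ u∈ w∈ u≢w → adjacent-complete (meet _ _ u∈ w∈ u≢w)

noCliqueAbove13 :
  cliqueSizeAtMost _≟ᵇ_ (adjacentIn adjacencyTable) (length allBlocks) allBlocks 13 ≡ true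
noCliqueAbove13 = refl

C₁-isMaximumClique : IsMaximumClique C₁
C₁-isMaximumClique = from-yes (isClique? C₁) , λ D D-clique →
  cliqueSizeAtMost-sound _≟ᵇ_ (adjacentIn adjacencyTable) (length allBlocks) allBlocks 13
    noCliqueAbove13 (clique⇒cliqueᵇ D-clique) (λ {u} _ → ∈-allBlocks u)

-- B₁₁⁰ and B₁₁² meet only in ∞, which is not on B₁¹¹.
noCommonPoint : ∀ {p} → p ∈ block (B 11 0) → p ∈ block (B 11 2) → p ∉ block (B 1 11)
noCommonPoint = All.lookup (from-yes (all? onAll? (block (B 11 0))))
  where
  open DecMembership _≟ᵖ_ using (_∈?_)
  onAll? : ∀ p → Dec (p ∈ block (B 11 2) → p ∉ block (B 1 11))
  onAll? p = p ∈? block (B 11 2) →-dec ¬? (p ∈? block (B 1 11))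

C₁-nonCanonical : ¬ IsCanonical C₁
C₁-nonCanonical (p , C₁≡star) =
  noCommonPoint (onBlock (B 11 0)) (onBlock (B 11 2)) (onBlock (B 1 11))
  where
  open DecMembership _≟ᵇ_ using (_∈?_)
  onBlock : ∀ u → {u∈C₁ : True (u ∈? C₁)} → p ∈ block u
  onBlock u {u∈C₁} = Equivalence.to (C₁≡star u) (toWitness u∈C₁)

proposition3p1 : IsMaximumClique C₁ × ¬ IsCanonical C₁
proposition3p1 = C₁-isMaximumClique , C₁-nonCanonical
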